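{- Let $H$ be the graph on the seven vertices $A,B,C,D,E,F,G$ whose edges are exactly $AC, AD, AE, AF, AG, BD, BE, CE, CF, CG, DE, DG, EG$. Any graph that contains an induced subgraph isomorphic to $H$ is not a divisor graph.
   Context: For a nonempty set $S$ of positive integers, the divisor graph $G(S)$ has vertex set $S$, with distinct $i,j$ adjacent iff $i\mid j$ or $j\mid i$. A graph $G$ is a divisor graph if $G\cong G(S)$ for some set $S$ of positive integers. -}

module Defs where

open import Data.Nat using (ℕ; _>_)
open import Data.Nat.Divisibility using (_∣_)
open import Data.Fin using (Fin; #_)
open import Data.Product using (_×_; _,_; Σ)
open import Data.Sum using (_⊎_)
open import Data.List using (List; _∷_; [])
open import Data.List.Membership.Propositional using (_∈_)
open import Relation.Binary.PropositionalEquality using (_≡_)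
open import Relation.Nullary using (¬_)
open import Function.Bundles using (_⇔_)
open import Function.Definitions using (Injective)

record Graph : Set₁ where
  field
    V     : Set
    Adj   : V → V → Set
    sym   : ∀ {u v} → Adj u v → Adj v u
    irrefl : ∀ {u} → ¬ Adj u u
open Graph public

-- G is a divisor graph: G ≅ G(S) for a set S of positive integers.
-- An isomorphism onto G(S) is the same as an injective labelling
-- ℓ : V → ℕ with positive values (S = image of ℓ) such that distinct
-- vertices are adjacent iff one label divides the other.
IsDivisorGraph : Graph → Set
IsDivisorGraph G =
  Σ (V G → ℕ) λ ℓ →
    Injective _≡_ _≡_ ℓ ×
    (∀ v → ℓ v > 0) ×
    (∀ u v → ¬ u ≡ v → (Adj G u v ⇔ (ℓ u ∣ ℓ v ⊎ ℓ v ∣ ℓ u)))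

-- The graph H on vertices A,B,C,D,E,F,G ↦ 0,1,2,3,4,5,6 (as Fin 7).
-- Edges: AC AD AE AF AG BD BE CE CF CG DE DG EG.
H-edges : List (Fin 7 × Fin 7)
H-edges =
  (# 0 , # 2) ∷ (# 0 , # 3) ∷ (# 0 , # 4) ∷ (# 0 , # 5) ∷ (# 0 , # 6) ∷
  (# 1 , # 3) ∷ (# 1 , # 4) ∷
  (# 2 , # 4) ∷ (# 2 , # 5) ∷ (# 2 , # 6) ∷
  (# 3 , # 4) ∷ (# 3 , # 6) ∷
  (# 4 , # 6) ∷ []

H-Adj : Fin 7 → Fin 7 → Set
H-Adj i j = (i , j) ∈ H-edges ⊎ (j , i) ∈ H-edges

ContainsInducedH : Graph → Set
ContainsInducedH G =
  Σ (Fin 7 → V G) λ φ →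
    Injective _≡_ _≡_ φ ×
    (∀ i j → (Adj G (φ i) (φ j) ⇔ H-Adj i j))

-- A divisor graph is the comparability graph of the divisibility order, so it suffices to
-- show that H has no transitive orientation.  Orient BD as B → D, say (the other case is
-- the same argument for the reversed relation).  The non-edges AB, BG, DF, EF, BC, FG then
-- force, one after another, A → D, G → D, A → F, A → E, B → E, C → E, C → F, C → G, and so
-- C → G → D contradicts the non-edge CD.
module Submission where

open import Defs
open import Data.Fin using (Fin; #_; _≟_)
open import Data.Product using (_,_)
open import Data.Product.Properties using (≡-dec)
open import Data.Sum using (_⊎_; inj₁; [_,_]; swap)
open import Data.Empty using (⊥; ⊥-elim)
open import Data.List.Membership.DecPropositional (≡-dec (_≟_ {7}) (_≟_ {7})) using (_∈?_)
open import Data.Nat.Divisibility using (_∣_; ∣-trans)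
open import Function using (id; flip; _∘_)
open import Function.Bundles using (Equivalence)
open import Relation.Binary.Core using (Rel)
open import Relation.Binary.Definitions using (Transitive; Decidable)
open import Relation.Binary.PropositionalEquality using (_≢_; subst) renaming (sym to ≡-sym)
open import Relation.Nullary using (¬_)
open import Relation.Nullary.Decidable using (True; False; toWitness; toWitnessFalse; _⊎-dec_)

H-Adj? : Decidable H-Adj
H-Adj? i j = ((i , j) ∈? H-edges) ⊎-dec ((j , i) ∈? H-edges)

H-Adj-sym : ∀ {i j} → H-Adj i j → H-Adj j i
H-Adj-sym = swap

A B C D E F G : Fin 7
A = # 0
B = # 1
C = # 2
D = # 3
E = # 4
F = # 5
G = # 6

Adj⇒≢ : (Γ : Graph) → ∀ {u v} → Adj Γ u v → u ≢ v
Adj⇒≢ Γ uv u≡v = irrefl Γ (subst (Adj Γ _) (≡-sym u≡v) uv)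

module Orientation {a r} {X : Set a} (_≼_ : Rel X r) (≼-trans : Transitive _≼_)
  (x : Fin 7 → X)
  (comparable : ∀ {i j} → H-Adj i j → x i ≼ x j ⊎ x j ≼ x i)
  (incomparable : ∀ {i j} → i ≢ j → ¬ H-Adj i j → ¬ x i ≼ x j)
  where

  private
    _⇒_ : Fin 7 → Fin 7 → Set r
    i ⇒ j = x i ≼ x j

    forced : ∀ i j {edge : True (H-Adj? i j)} → ¬ j ⇒ i → i ⇒ j
    forced i j {edge} j⇏i = [ id , ⊥-elim ∘ j⇏i ] (comparable (toWitness {a? = H-Adj? i j} edge))

    barred : ∀ i j {i≢j : False (i ≟ j)} {nonEdge : False (H-Adj? i j)} → ¬ i ⇒ j
    barred i j {i≢j} {nonEdge} =
      incomparable (toWitnessFalse {a? = i ≟ j} i≢j) (toWitnessFalse {a? = H-Adj? i j} nonEdge)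

    _⨾_ : ∀ {i j k} → i ⇒ j → j ⇒ k → i ⇒ k
    _⨾_ = ≼-trans

  B⇏D : ¬ B ⇒ D
  B⇏D B⇒D = barred C D (C⇒G ⨾ G⇒D)
    where
    A⇒D : A ⇒ D
    A⇒D = forced A D λ D⇒A → barred B A (B⇒D ⨾ D⇒A)
    G⇒D : G ⇒ D
    G⇒D = forced G D λ D⇒G → barred B G (B⇒D ⨾ D⇒G)
    A⇒F : A ⇒ F
    A⇒F = forced A F λ F⇒A → barred F D (F⇒A ⨾ A⇒D)
    A⇒E : A ⇒ E
    A⇒E = forced A E λ E⇒A → barred E F (E⇒A ⨾ A⇒F)
    B⇒E : B ⇒ E
    B⇒E = forced B E λ E⇒B → barred A B (A⇒E ⨾ E⇒B)
    C⇒E : C ⇒ E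
    C⇒E = forced C E λ E⇒C → barred B C (B⇒E ⨾ E⇒C)
    C⇒F : C ⇒ F
    C⇒F = forced C F λ F⇒C → barred F E (F⇒C ⨾ C⇒E)
    C⇒G : C ⇒ G
    C⇒G = forced C G λ G⇒C → barred G F (G⇒C ⨾ C⇒F)

H-notComparabilityGraph : ∀ {a r} {X : Set a} (_≼_ : Rel X r) → Transitive _≼_ →
  (x : Fin 7 → X) →
  (∀ {i j} → H-Adj i j → x i ≼ x j ⊎ x j ≼ x i) →
  (∀ {i j} → i ≢ j → ¬ H-Adj i j → ¬ x i ≼ x j) → ⊥
H-notComparabilityGraph _≼_ ≼-trans x comparable incomparable =
  [_,_] {C = λ _ → ⊥}
    (Orientation.B⇏D _≼_ ≼-trans x comparable incomparable)
    (Orientation.B⇏D (flip _≼_) (flip ≼-trans) x (swap ∘ comparable) incomparableᵒ)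
    (comparable (toWitness {a? = H-Adj? B D} _))
  where
  incomparableᵒ : ∀ {i j} → i ≢ j → ¬ H-Adj i j → ¬ x j ≼ x i
  incomparableᵒ i≢j ¬adj = incomparable (i≢j ∘ ≡-sym) (¬adj ∘ H-Adj-sym)

lemma2p1 : (G : Graph) → ContainsInducedH G → ¬ IsDivisorGraph G
lemma2p1 G (φ , φ-injective , φ-induced) (ℓ , _ , _ , adj⇔divides) =
  H-notComparabilityGraph _∣_ ∣-trans (ℓ ∘ φ) comparable incomparable
  where
  comparable : ∀ {i j} → H-Adj i j → ℓ (φ i) ∣ ℓ (φ j) ⊎ ℓ (φ j) ∣ ℓ (φ i)
  comparable {i} {j} ij = Equivalence.to (adj⇔divides (φ i) (φ j) (Adj⇒≢ G φiφj)) φiφj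
    where
    φiφj : Adj G (φ i) (φ j)
    φiφj = Equivalence.from (φ-induced i j) ij

  incomparable : ∀ {i j} → i ≢ j → ¬ H-Adj i j → ¬ ℓ (φ i) ∣ ℓ (φ j)
  incomparable {i} {j} i≢j ¬ij ∣ij =
    ¬ij (Equivalence.to (φ-induced i j)
      (Equivalence.from (adj⇔divides (φ i) (φ j) (i≢j ∘ φ-injective)) (inj₁ ∣ij)))
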